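{- Let $P$ be an oriented hitomezashi path. If $P$ has at least one horizontal stitch at latitude $y$, then all of the horizontal stitches of $P$ at latitude $y$ are oriented in the same direction (all west-to-east or all east-to-west). Analogously, if $P$ has at least one vertical stitch at longitude $x$, then all of the vertical stitches of $P$ at longitude $x$ are oriented in the same direction (all south-to-north or all north-to-south).
   Context: A hitomezashi pattern is determined by labels $\epsilon_i\in\{0,1\}$ for every integer $i$ and $\eta_j\in\{0,1\}$ for every integer $j$. Its vertical stitches are the unit segments from $(i,j)$ to $(i,j+1)$ for all integers $i,j$ with $j\equiv \epsilon_i \pmod 2$; its horizontal stitches are the unit segments from $(i,j)$ to $(i+1,j)$ for all integers $i,j$ with $i\equiv \eta_j\pmod 2$. A hitomezashi path is a curve (embedded in the plane, not necessarily maximal) formed by a union of stitches of a hitomezashi pattern; it is oriented by choosing a direction of traversal, which orients each of its stitches. The latitude of a horizontal stitch is its $y$-coordinate; the longitude of a vertical stitch is its $x$-coordinate. -}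

module Defs where

open import Data.Nat as ℕ using (ℕ; suc; _≥_)
open import Data.Integer using (ℤ; +_; _+_; _-_)
open import Data.Integer.Divisibility using (_∣_)
open import Data.Fin using (Fin; toℕ; inject₁; fromℕ<; zero; suc)
open import Data.Product using (_×_; _,_; ∃; ∃-syntax; proj₁; proj₂)
open import Relation.Binary.PropositionalEquality using (_≡_)
open import Relation.Nullary using (yes; no)
open import Function.Definitions using (Injective)

record Pattern : Set where
  field
    ε : ℤ → Fin 2
    η : ℤ → Fin 2
open Pattern public

Point : Set
Point = ℤ × ℤ

-- The vertical unit segment (i,j)-(i,j+1) is a stitch iff j ≡ ε_i (mod 2).
VStitch : Pattern → ℤ → ℤ → Set
VStitch P i j = + 2 ∣ (j - + toℕ (ε P i))

-- The horizontal unit segment (i,j)-(i+1,j) is a stitch iff i ≡ η_j (mod 2).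
HStitch : Pattern → ℤ → ℤ → Set
HStitch P i j = + 2 ∣ (i - + toℕ (η P j))

data Stitch (P : Pattern) : Point → Point → Set where
  north : ∀ {i j} → VStitch P i j → Stitch P (i , j) (i , j + + 1)
  south : ∀ {i j} → VStitch P i j → Stitch P (i , j + + 1) (i , j)
  east  : ∀ {i j} → HStitch P i j → Stitch P (i , j) (i + + 1 , j)
  west  : ∀ {i j} → HStitch P i j → Stitch P (i + + 1 , j) (i , j)

next : ∀ {m} → Fin (suc m) → Fin (suc m)
next {m} k with suc (toℕ k) ℕ.<? suc m
... | yes p = fromℕ< p
... | no _  = zero

-- An oriented hitomezashi path: an embedded curve that is a union of stitches,
-- given by its (distinct) lattice vertices in order of traversal.
data HPath (P : Pattern) : Set where
  arc  : (n : ℕ) (v : Fin (suc n) → Point) → Injective _≡_ _≡_ v →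
         (∀ (k : Fin n) → Stitch P (v (inject₁ k)) (v (suc k))) → HPath P
  loop : (m : ℕ) → m ≥ 2 → (v : Fin (suc m) → Point) → Injective _≡_ _≡_ v →
         (∀ (k : Fin (suc m)) → Stitch P (v k) (v (next k))) → HPath P
  ray  : (v : ℕ → Point) → Injective _≡_ _≡_ v →
         (∀ (k : ℕ) → Stitch P (v k) (v (suc k))) → HPath P
  line : (v : ℤ → Point) → Injective _≡_ _≡_ v →
         (∀ (k : ℤ) → Stitch P (v k) (v (k + + 1))) → HPath P

Traverses : ∀ {P} → HPath P → Point → Point → Set
Traverses (arc n v _ _)    a b = ∃[ k ] (v (inject₁ k) ≡ a × v (suc k) ≡ b)
Traverses (loop m _ v _ _) a b = ∃[ k ] (v k ≡ a × v (next k) ≡ b)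
Traverses (ray v _ _)      a b = ∃[ k ] (v k ≡ a × v (suc k) ≡ b)
Traverses (line v _ _)     a b = ∃[ k ] (v k ≡ a × v (k + + 1) ≡ b)

-- Colour the lattice points by the parity of x + y. Every vertex lies on exactly one
-- horizontal and one vertical stitch, so an embedded path alternates between horizontal and
-- vertical stitches; the colour of the tail alternates as well, hence their xor (the spin)
-- is constant along the path. For a horizontal stitch at latitude y the spin fixes the parity
-- of the tail's x-coordinate, and the rule x ≡ η_y (mod 2) then fixes whether the stitch runs
-- east or west. Swapping the axes gives the vertical case.

module Submission where

open import Defs
open import Data.Integer using (ℤ; _-_)
open import Data.Product using (_×_; proj₁; proj₂)
open import Relation.Binary.PropositionalEquality using (_≡_)

open import Data.Bool using (Bool; true; false; not; _xor_)
open import Data.Bool.Properties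
  using (not-involutive; not-injective; not-¬; xor-same; xor-inverseˡ; xor-comm;
         not-distribˡ-xor; not-distribʳ-xor; xor-annihilates-not;
         xor-∧-commutativeRing)
open import Algebra.Bundles using (CommutativeRing)
open import Algebra.Properties.Group (CommutativeRing.+-group xor-∧-commutativeRing)
  using (∙-cancelʳ)
open import Data.Empty using (⊥-elim)
open import Data.Fin using (Fin; zero; suc; toℕ; inject₁)
import Data.Fin.Properties as Finₚ
open import Data.Integer using (+_; -[1+_]; -1ℤ; _+_; ∣_∣)
import Data.Integer.Properties as ℤₚ
open import Data.Integer.Divisibility using (_∣_)
open import Data.Integer.Tactic.RingSolver using (solve-∀)
open import Data.Nat as ℕ using (ℕ; s≤s; z≤n)
import Data.Nat.Divisibility as ℕ
import Data.Nat.Properties as ℕₚ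
open import Data.Product using (_,_; swap)
open import Data.Sum using (_⊎_; inj₁; inj₂)
open import Relation.Nullary using (yes; no)
open import Relation.Binary.PropositionalEquality
  using (_≢_; refl; sym; trans; cong; cong₂; module ≡-Reasoning)

private
  variable
    P : Pattern
    a b c d : Point

isOddℕ : ℕ → Bool
isOddℕ ℕ.zero    = false
isOddℕ (ℕ.suc n) = not (isOddℕ n)

isOdd : ℤ → Bool
isOdd i = isOddℕ ∣ i ∣

isOddℕ-+1 : ∀ n → isOddℕ (n ℕ.+ 1) ≡ not (isOddℕ n)
isOddℕ-+1 ℕ.zero    = refl
isOddℕ-+1 (ℕ.suc n) = cong not (isOddℕ-+1 n)

isOdd-+1 : ∀ i → isOdd (i + + 1) ≡ not (isOdd i)
isOdd-+1 (+ n)              = isOddℕ-+1 n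
isOdd-+1 -[1+ ℕ.zero ]      = refl
isOdd-+1 -[1+ ℕ.suc n ]     = sym (not-involutive _)

2∣⇒¬isOdd : ∀ i → + 2 ∣ i → isOdd i ≡ false
2∣⇒¬isOdd _ (ℕ.divides q eq) rewrite eq = isOddℕ-*2 q
  where
  isOddℕ-*2 : ∀ q → isOddℕ (q ℕ.* 2) ≡ false
  isOddℕ-*2 ℕ.zero    = refl
  isOddℕ-*2 (ℕ.suc q) = trans (not-involutive _) (isOddℕ-*2 q)

bit : Fin 2 → Bool
bit zero       = false
bit (suc zero) = true

isOdd-congruent : ∀ i t → + 2 ∣ (i - + toℕ t) → isOdd i ≡ bit t
isOdd-congruent i zero 2∣i = trans (cong isOdd (sym (ℤₚ.+-identityʳ i))) (2∣⇒¬isOdd (i + + 0) 2∣i)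
isOdd-congruent i (suc zero) 2∣i-1 = begin
  isOdd i                    ≡⟨ cong isOdd (sym (i-1+1≡i i)) ⟩
  isOdd ((i - + 1) + + 1)    ≡⟨ isOdd-+1 (i - + 1) ⟩
  not (isOdd (i - + 1))      ≡⟨ cong not (2∣⇒¬isOdd (i - + 1) 2∣i-1) ⟩
  true                       ∎
  where
  open ≡-Reasoning
  i-1+1≡i : ∀ i → (i - + 1) + + 1 ≡ i
  i-1+1≡i = solve-∀

isHorizontal : Stitch P a b → Bool
isHorizontal (north _) = false
isHorizontal (south _) = false
isHorizontal (east _)  = true
isHorizontal (west _)  = true

transpose : Pattern → Pattern
transpose P = record { ε = η P ; η = ε P }

transposeStitch : Stitch P a b → Stitch (transpose P) (swap a) (swap b)
transposeStitch (north s) = east s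
transposeStitch (south s) = west s
transposeStitch (east s)  = north s
transposeStitch (west s)  = south s

isHorizontal-transpose : (s : Stitch P a b) → isHorizontal (transposeStitch s) ≡ not (isHorizontal s)
isHorizontal-transpose (north _) = refl
isHorizontal-transpose (south _) = refl
isHorizontal-transpose (east _)  = refl
isHorizontal-transpose (west _)  = refl

level-stitch-isHorizontal : (s : Stitch P a b) → proj₂ a ≡ proj₂ b → isHorizontal s ≡ true
level-stitch-isHorizontal (north {j = j} _) j≡j+1 = ⊥-elim (not-¬ (cong isOdd (sym j≡j+1)) (isOdd-+1 j))
level-stitch-isHorizontal (south {j = j} _) j+1≡j = ⊥-elim (not-¬ (cong isOdd j+1≡j) (isOdd-+1 j))
level-stitch-isHorizontal (east _) _ = refl
level-stitch-isHorizontal (west _) _ = refl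

unitStep : Bool → ℤ
unitStep false = + 1
unitStep true  = -1ℤ

-- The other end of the unique horizontal stitch through a vertex.
horizontalMate : Pattern → Point → Point
horizontalMate P (x , y) = x + unitStep (isOdd x xor bit (η P y)) , y

horizontalMate-left : ∀ P i j → HStitch P i j → horizontalMate P (i , j) ≡ (i + + 1 , j)
horizontalMate-left P i j h = cong (λ z → i + unitStep z , j) (begin
  isOdd i xor bit (η P j)        ≡⟨ cong (_xor bit (η P j)) (isOdd-congruent i (η P j) h) ⟩
  bit (η P j) xor bit (η P j)    ≡⟨ xor-same (bit (η P j)) ⟩
  false                          ∎)
  where open ≡-Reasoning

horizontalMate-right : ∀ P i j → HStitch P i j → horizontalMate P (i + + 1 , j) ≡ (i , j)
horizontalMate-right P i j h = cong (_, j) (begin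
  (i + + 1) + unitStep (isOdd (i + + 1) xor bit (η P j))  ≡⟨ cong (λ z → (i + + 1) + unitStep z) odd-step ⟩
  (i + + 1) + -1ℤ                                        ≡⟨ i+1-1≡i i ⟩
  i                                                      ∎)
  where
  open ≡-Reasoning
  i+1-1≡i : ∀ i → (i + + 1) + -1ℤ ≡ i
  i+1-1≡i = solve-∀
  odd-step : isOdd (i + + 1) xor bit (η P j) ≡ true
  odd-step = begin
    isOdd (i + + 1) xor bit (η P j)     ≡⟨ cong (_xor bit (η P j)) (isOdd-+1 i) ⟩
    not (isOdd i) xor bit (η P j)       ≡⟨ cong (λ z → not z xor bit (η P j)) (isOdd-congruent i (η P j) h) ⟩
    not (bit (η P j)) xor bit (η P j)   ≡⟨ xor-inverseˡ (bit (η P j)) ⟩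
    true                                ∎

horizontal-stitch-mates : (s : Stitch P a b) → isHorizontal s ≡ true →
  horizontalMate P a ≡ b × horizontalMate P b ≡ a
horizontal-stitch-mates {P} (east {i} {j} h) _ = horizontalMate-left P i j h , horizontalMate-right P i j h
horizontal-stitch-mates {P} (west {i} {j} h) _ = horizontalMate-right P i j h , horizontalMate-left P i j h

consecutive-horizontal-backtrack : (s : Stitch P a b) (t : Stitch P b c) →
  isHorizontal s ≡ true → isHorizontal t ≡ true → a ≡ c
consecutive-horizontal-backtrack s t hs ht =
  trans (sym (proj₂ (horizontal-stitch-mates s hs))) (proj₁ (horizontal-stitch-mates t ht))

stitch-turns : (s : Stitch P a b) (t : Stitch P b c) → a ≢ c → isHorizontal t ≡ not (isHorizontal s)
stitch-turns s t a≢c with isHorizontal s in hs | isHorizontal t in ht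
... | true  | false = refl
... | false | true  = refl
... | true  | true  = ⊥-elim (a≢c (consecutive-horizontal-backtrack s t hs ht))
... | false | false = ⊥-elim (a≢c (cong swap (consecutive-horizontal-backtrack
  (transposeStitch s) (transposeStitch t)
  (trans (isHorizontal-transpose s) (cong not hs)) (trans (isHorizontal-transpose t) (cong not ht)))))

colour : Point → Bool
colour (x , y) = isOdd x xor isOdd y

colour-swap : ∀ a → colour (swap a) ≡ colour a
colour-swap (x , y) = xor-comm (isOdd y) (isOdd x)

colour-right : ∀ i j → colour (i + + 1 , j) ≡ not (colour (i , j))
colour-right i j = trans (cong (_xor isOdd j) (isOdd-+1 i)) (sym (not-distribˡ-xor (isOdd i) (isOdd j)))

colour-above : ∀ i j → colour (i , j + + 1) ≡ not (colour (i , j))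
colour-above i j = trans (cong (isOdd i xor_) (isOdd-+1 j)) (sym (not-distribʳ-xor (isOdd i) (isOdd j)))

colour-flips : Stitch P a b → colour b ≡ not (colour a)
colour-flips (north {i} {j} _) = colour-above i j
colour-flips (south {i} {j} _) = sym (trans (cong not (colour-above i j)) (not-involutive _))
colour-flips (east {i} {j} _)  = colour-right i j
colour-flips (west {i} {j} _)  = sym (trans (cong not (colour-right i j)) (not-involutive _))

spin : Stitch P a b → Bool
spin {a = a} s = isHorizontal s xor colour a

spin-step : (s : Stitch P a b) (t : Stitch P b c) → a ≢ c → spin s ≡ spin t
spin-step {a = a} {b = b} s t a≢c = sym (begin
  isHorizontal t xor colour b                  ≡⟨ cong₂ _xor_ (stitch-turns s t a≢c) (colour-flips s) ⟩
  not (isHorizontal s) xor not (colour a)      ≡⟨ xor-annihilates-not (isHorizontal s) (colour a) ⟩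
  isHorizontal s xor colour a                  ∎)
  where open ≡-Reasoning

spin-transpose : (s : Stitch P a b) → spin (transposeStitch s) ≡ not (spin s)
spin-transpose {a = a} s = begin
  isHorizontal (transposeStitch s) xor colour (swap a)  ≡⟨ cong₂ _xor_ (isHorizontal-transpose s) (colour-swap a) ⟩
  not (isHorizontal s) xor colour a                     ≡⟨ not-distribˡ-xor (isHorizontal s) (colour a) ⟨
  not (isHorizontal s xor colour a)                     ∎
  where open ≡-Reasoning

horizontal-displacement : (s : Stitch P a b) → isHorizontal s ≡ true →
  proj₁ b - proj₁ a ≡ unitStep (isOdd (proj₁ a) xor bit (η P (proj₂ a)))
horizontal-displacement {P} {a} {b} s hs = begin
  proj₁ b - x                                   ≡⟨ cong (_- x) (cong proj₁ (proj₁ (horizontal-stitch-mates s hs))) ⟨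
  (x + unitStep (isOdd x xor bit (η P y))) - x  ≡⟨ x+u-x≡u x (unitStep (isOdd x xor bit (η P y))) ⟩
  unitStep (isOdd x xor bit (η P y))            ∎
  where
  open ≡-Reasoning
  x y : ℤ
  x = proj₁ a
  y = proj₂ a
  x+u-x≡u : ∀ x u → (x + u) - x ≡ u
  x+u-x≡u = solve-∀

horizontal-stitches-agree : (s : Stitch P a b) (t : Stitch P c d) → spin s ≡ spin t →
  proj₂ a ≡ proj₂ b → proj₂ c ≡ proj₂ d → proj₂ a ≡ proj₂ c →
  proj₁ b - proj₁ a ≡ proj₁ d - proj₁ c
horizontal-stitches-agree {P} {a} {b} {c} {d} s t same-spin ya≡yb yc≡yd ya≡yc = begin
  proj₁ b - proj₁ a                                      ≡⟨ horizontal-displacement s hs ⟩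
  unitStep (isOdd (proj₁ a) xor bit (η P (proj₂ a)))     ≡⟨ cong₂ (λ p y → unitStep (p xor bit (η P y))) same-parity ya≡yc ⟩
  unitStep (isOdd (proj₁ c) xor bit (η P (proj₂ c)))     ≡⟨ horizontal-displacement t ht ⟨
  proj₁ d - proj₁ c                                      ∎
  where
  open ≡-Reasoning
  hs : isHorizontal s ≡ true
  hs = level-stitch-isHorizontal s ya≡yb
  ht : isHorizontal t ≡ true
  ht = level-stitch-isHorizontal t yc≡yd
  same-colour : colour a ≡ colour c
  same-colour = not-injective (begin
    not (colour a)              ≡⟨ cong (_xor colour a) hs ⟨
    spin s                      ≡⟨ same-spin ⟩
    spin t                      ≡⟨ cong (_xor colour c) ht ⟩
    not (colour c)              ∎)
  same-parity : isOdd (proj₁ a) ≡ isOdd (proj₁ c)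
  same-parity = ∙-cancelʳ (isOdd (proj₂ a)) _ _
    (trans same-colour (cong (λ y → isOdd (proj₁ c) xor isOdd y) (sym ya≡yc)))

vertical-stitches-agree : (s : Stitch P a b) (t : Stitch P c d) → spin s ≡ spin t →
  proj₁ a ≡ proj₁ b → proj₁ c ≡ proj₁ d → proj₁ a ≡ proj₁ c →
  proj₂ b - proj₂ a ≡ proj₂ d - proj₂ c
vertical-stitches-agree s t same-spin =
  horizontal-stitches-agree (transposeStitch s) (transposeStitch t)
    (trans (spin-transpose s) (trans (cong not same-spin) (sym (spin-transpose t))))

stepwise-constant-Fin : ∀ {ℓ} {A : Set ℓ} {n} (f : Fin (ℕ.suc n) → A) →
  (∀ k → f (inject₁ k) ≡ f (suc k)) → ∀ k → f k ≡ f zero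
stepwise-constant-Fin f step zero = refl
stepwise-constant-Fin {n = ℕ.suc n} f step (suc k) =
  trans (stepwise-constant-Fin (λ j → f (suc j)) (λ j → step (suc j)) k) (sym (step zero))

stepwise-constant-ℕ : ∀ {ℓ} {A : Set ℓ} (f : ℕ → A) → (∀ k → f k ≡ f (ℕ.suc k)) → ∀ k → f k ≡ f 0
stepwise-constant-ℕ f step ℕ.zero    = refl
stepwise-constant-ℕ f step (ℕ.suc k) = trans (sym (step k)) (stepwise-constant-ℕ f step k)

stepwise-constant-ℤ : ∀ {ℓ} {A : Set ℓ} (f : ℤ → A) → (∀ k → f k ≡ f (k + + 1)) → ∀ k → f k ≡ f (+ 0)
stepwise-constant-ℤ f step (+ ℕ.zero)       = refl
stepwise-constant-ℤ f step (+ ℕ.suc n)      =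
  trans (cong (λ m → f (+ m)) (ℕₚ.+-comm 1 n)) (trans (sym (step (+ n))) (stepwise-constant-ℤ f step (+ n)))
stepwise-constant-ℤ f step -[1+ ℕ.zero ]    = step -[1+ ℕ.zero ]
stepwise-constant-ℤ f step -[1+ ℕ.suc n ]   = trans (step -[1+ ℕ.suc n ]) (stepwise-constant-ℤ f step -[1+ n ])

inject₁²≢suc² : ∀ {n} (j : Fin n) → inject₁ (inject₁ j) ≢ suc (suc j)
inject₁²≢suc² j eq = ℕₚ.m≢1+n+m (toℕ j) {1} (begin
  toℕ j                        ≡⟨ Finₚ.toℕ-inject₁ j ⟨
  toℕ (inject₁ j)              ≡⟨ Finₚ.toℕ-inject₁ (inject₁ j) ⟨
  toℕ (inject₁ (inject₁ j))    ≡⟨ cong toℕ eq ⟩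
  toℕ (suc (suc j))            ∎)
  where open ≡-Reasoning

i≢i+1+1 : ∀ i → i ≢ (i + + 1) + + 1
i≢i+1+1 i eq = 0≢2 (trans (sym (ℤₚ.+-inverseʳ i)) (trans (cong (_- i) eq) (i+2-i≡2 i)))
  where
  i+2-i≡2 : ∀ i → ((i + + 1) + + 1) - i ≡ + 2
  i+2-i≡2 = solve-∀
  0≢2 : + 0 ≢ + 2
  0≢2 ()

toℕ-next : ∀ {m} (k : Fin (ℕ.suc m)) →
  toℕ (next k) ≡ ℕ.suc (toℕ k) ⊎ (toℕ (next k) ≡ 0 × toℕ k ≡ m)
toℕ-next {m} k with ℕ.suc (toℕ k) ℕ.<? ℕ.suc m
... | yes k+1<1+m = inj₁ (Finₚ.toℕ-fromℕ< k+1<1+m)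
... | no  k+1≮1+m = inj₂ (refl , ℕₚ.≤-antisym (ℕₚ.≤-pred (Finₚ.toℕ<n k)) (ℕₚ.≤-pred (ℕₚ.≮⇒≥ k+1≮1+m)))

next-inject₁ : ∀ {m} (j : Fin m) → next (inject₁ j) ≡ suc j
next-inject₁ j with toℕ-next (inject₁ j)
... | inj₁ eq        = Finₚ.toℕ-injective (trans eq (cong ℕ.suc (Finₚ.toℕ-inject₁ j)))
... | inj₂ (_ , eq)  = ⊥-elim (ℕₚ.<⇒≢ (Finₚ.toℕ<n j) (trans (sym (Finₚ.toℕ-inject₁ j)) eq))

next²≢ : ∀ {m} → m ℕ.≥ 2 → (k : Fin (ℕ.suc m)) → k ≢ next (next k)
next²≢ {m} m≥2 k k≡next²k with cong toℕ k≡next²k | toℕ-next k | toℕ-next (next k)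
... | t≡ | inj₁ e₁        | inj₁ e₂        = ℕₚ.m≢1+n+m (toℕ k) {1} (trans t≡ (trans e₂ (cong ℕ.suc e₁)))
... | t≡ | inj₁ e₁        | inj₂ (e₂ , e₃) = ℕₚ.>⇒≢ m≥2 (trans (sym e₃) (trans e₁ (cong ℕ.suc (trans t≡ e₂))))
... | t≡ | inj₂ (e₁ , e₂) | inj₁ e₃        = ℕₚ.>⇒≢ m≥2 (trans (sym e₂) (trans t≡ (trans e₃ (cong ℕ.suc e₁))))
... | _  | inj₂ (e₁ , _)  | inj₂ (_ , e₄)  = ℕₚ.>⇒≢ (ℕₚ.<-trans (s≤s z≤n) m≥2) (trans (sym e₄) e₁)

traversedStitch : (γ : HPath P) → Traverses γ a b → Stitch P a b
traversedStitch (arc _ _ _ s)    (k , refl , refl) = s k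
traversedStitch (loop _ _ _ _ s) (k , refl , refl) = s k
traversedStitch (ray _ _ s)      (k , refl , refl) = s k
traversedStitch (line _ _ s)     (k , refl , refl) = s k

spin-constant : (γ : HPath P) (t : Traverses γ a b) (u : Traverses γ c d) →
  spin (traversedStitch γ t) ≡ spin (traversedStitch γ u)
spin-constant (arc ℕ.zero _ _ _) (() , _)
spin-constant (arc (ℕ.suc n) v inj s) (k , refl , refl) (l , refl , refl) =
  trans (to-first k) (sym (to-first l))
  where
  to-first : ∀ k → spin (s k) ≡ spin (s zero)
  to-first = stepwise-constant-Fin (λ k → spin (s k)) λ j →
    spin-step (s (inject₁ j)) (s (suc j)) (λ eq → inject₁²≢suc² j (inj eq))
spin-constant (loop m m≥2 v inj s) (k , refl , refl) (l , refl , refl) =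
  trans (to-first k) (sym (to-first l))
  where
  step : ∀ k → spin (s k) ≡ spin (s (next k))
  step k = spin-step (s k) (s (next k)) (λ eq → next²≢ m≥2 k (inj eq))
  to-first : ∀ k → spin (s k) ≡ spin (s zero)
  to-first = stepwise-constant-Fin (λ k → spin (s k)) λ j →
    trans (step (inject₁ j)) (cong (λ k → spin (s k)) (next-inject₁ j))
spin-constant (ray v inj s) (k , refl , refl) (l , refl , refl) =
  trans (to-first k) (sym (to-first l))
  where
  to-first : ∀ k → spin (s k) ≡ spin (s 0)
  to-first = stepwise-constant-ℕ (λ k → spin (s k)) λ k →
    spin-step (s k) (s (ℕ.suc k)) (λ eq → ℕₚ.m≢1+n+m k {1} (inj eq))
spin-constant (line v inj s) (k , refl , refl) (l , refl , refl) =
  trans (to-first k) (sym (to-first l))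
  where
  to-first : ∀ k → spin (s k) ≡ spin (s (+ 0))
  to-first = stepwise-constant-ℤ (λ k → spin (s k)) λ k →
    spin-step (s k) (s (k + + 1)) (λ eq → i≢i+1+1 k (inj eq))

lemma2p3 : (P : Pattern) (γ : HPath P) →
    ((a b c d : Point) → Traverses γ a b → Traverses γ c d →
      proj₂ a ≡ proj₂ b → proj₂ c ≡ proj₂ d → proj₂ a ≡ proj₂ c →
      proj₁ b - proj₁ a ≡ proj₁ d - proj₁ c)
    ×
    ((a b c d : Point) → Traverses γ a b → Traverses γ c d →
      proj₁ a ≡ proj₁ b → proj₁ c ≡ proj₁ d → proj₁ a ≡ proj₁ c →
      proj₂ b - proj₂ a ≡ proj₂ d - proj₂ c)
lemma2p3 P γ =
  (λ _ _ _ _ t u → horizontal-stitches-agree (traversedStitch γ t) (traversedStitch γ u) (spin-constant γ t u)) ,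
  (λ _ _ _ _ t u → vertical-stitches-agree (traversedStitch γ t) (traversedStitch γ u) (spin-constant γ t u))
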